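{- Let $n\geq 3$ be an integer and let $A_n$ be the quartic antiprism graph of order $2n$. Then $A_n$ is a nut graph if and only if $n$ is not divisible by $3$.
   Context: All graphs are finite and simple. The antiprism graph $A_n$ ($n\geq 3$) is the circulant graph $\mathrm{Ci}_{2n}(1,2)$: its vertex set is $\mathbb{Z}_{2n}$ and $i$ is adjacent to $j$ if and only if $i-j \equiv \pm 1$ or $\pm 2 \pmod{2n}$; it is 4-regular. For a graph $G$ with 0--1 adjacency matrix $\mathbf{A}(G)$, the nullity is the multiplicity of $0$ as an eigenvalue of $\mathbf{A}(G)$. A vertex is a core vertex if it corresponds to a nonzero entry of some vector in $\ker \mathbf{A}(G)$; a core graph is a singular graph all of whose vertices are core vertices; a nut graph is a core graph of nullity one. -}

module Defs where

open import Data.Nat as ℕ using (ℕ; suc; _+_; _*_; _%_; _≡ᵇ_)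
open import Data.Bool using (Bool; true; false; _∨_; if_then_else_)
open import Data.Fin as Fin using (Fin; toℕ)
open import Data.Rational as ℚ using (ℚ; 0ℚ; 1ℚ)
open import Data.Product using (Σ; _×_; ∃; ∃-syntax)
open import Relation.Binary.PropositionalEquality using (_≡_; _≢_)

-- A graph on vertex set Fin m, given by its Boolean adjacency relation
-- (only used for the antiprism, which is simple: symmetric, irreflexive).
Graph : ℕ → Set
Graph m = Fin m → Fin m → Bool

Σᶠ : (m : ℕ) → (Fin m → ℚ) → ℚ
Σᶠ ℕ.zero f = 0ℚ
Σᶠ (suc m) f = f Fin.zero ℚ.+ Σᶠ m (λ i → f (Fin.suc i))

adjMatrix : ∀ {m} → Graph m → Fin m → Fin m → ℚ
adjMatrix G i j = if G i j then 1ℚ else 0ℚ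

InKernel : ∀ {m} → Graph m → (Fin m → ℚ) → Set
InKernel {m} G x = ∀ i → Σᶠ m (λ j → adjMatrix G i j ℚ.* x j) ≡ 0ℚ

NonZeroVec : ∀ {m} → (Fin m → ℚ) → Set
NonZeroVec x = ∃[ i ] (x i ≢ 0ℚ)

-- nullity = dim ker A(G) (= multiplicity of eigenvalue 0, A(G) symmetric)
-- nullity ≥ 1
Singular : ∀ {m} → Graph m → Set
Singular G = ∃[ x ] (InKernel G x × NonZeroVec x)

NullityOne : ∀ {m} → Graph m → Set
NullityOne {m} G =
  ∃[ x ] (InKernel G x × NonZeroVec x ×
          (∀ y → InKernel G y → ∃[ c ] (∀ i → y i ≡ c ℚ.* x i)))

CoreVertex : ∀ {m} → Graph m → Fin m → Set
CoreVertex G v = ∃[ x ] (InKernel G x × x v ≢ 0ℚ)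

CoreGraph : ∀ {m} → Graph m → Set
CoreGraph G = Singular G × (∀ v → CoreVertex G v)

NutGraph : ∀ {m} → Graph m → Set
NutGraph G = CoreGraph G × NullityOne G

-- antiprism A_n = Ci_{2n}(1,2) on Z_{2n}
-- i ~ j iff (i - j) mod 2n ∈ {1, 2, 2n-1, 2n-2}; computed as
-- (j + d) mod 2n ≡ i  or  (i + d) mod 2n ≡ j for d ∈ {1,2}.
antiprismAdj : (n : ℕ) → Fin (2 * n) → Fin (2 * n) → Bool
antiprismAdj n i j =
  step 1 i j ∨ step 2 i j ∨ step 1 j i ∨ step 2 j i
  where
  step : ℕ → Fin (2 * n) → Fin (2 * n) → Bool
  step d a b with 2 * n
  ... | ℕ.zero = false
  ... | suc k = ((toℕ b + d) % suc k) ≡ᵇ toℕ a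

antiprism : (n : ℕ) → Graph (2 * n)
antiprism = antiprismAdj

module Submission where

-- Put m = 2n and read a vector y : Fin m → ℚ as the m-periodic
-- sequence Y t = y (t mod m).  In A_n = Ci_m(1,2) the vertex k+2 has the
-- neighbours k, k+1, k+3, k+4, so y lies in ker A(A_n) exactly when
--     Y(k+1) + Y(k) + Y(k+3) + Y(k+4) = 0   for all k            (the recurrence).
-- For a solution the pair sums S k = Y k + Y (k+1) satisfy S (k+3) = - S k, so S
-- has period 6 as well as period 2n.  If 3 ∤ n then 2n mod 6 is 2 or 4, which forces
-- S (k+1) = - S k; then Y (k+2) = Y k - 2 S k, going once around the cycle gives
-- 2n · S 0 = 0, so S vanishes and Y k = (-1)^k Y 0.  Thus the kernel is spanned by
-- the alternating vector, which has no zero entry: A_n is a nut graph.  If 3 ∣ n the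
-- 6-periodic sequence 1, 1, 0, -1, -1, 0 is a second, independent solution.

open import Defs
open import Data.Nat using (ℕ; _≤_)
open import Data.Nat.Divisibility using (_∣_; divides; m%n≡0⇒n∣m)
open import Relation.Nullary using (¬_)
open import Function.Bundles using (_⇔_; mk⇔; Equivalence)

open import Data.Bool using (Bool; true; false; _∨_; if_then_else_; T)
open import Data.Bool.Properties using (T-∨)
open import Data.Empty using (⊥; ⊥-elim)
open import Data.Fin as Fin using (Fin; toℕ)
open import Data.Fin.Properties using (0≢1+n; toℕ-fromℕ<; fromℕ<-cong; toℕ-injective; toℕ<n)
  renaming (suc-injective to Fin-suc-injective)
open import Data.Nat as ℕ using (zero; suc; _<_; _%_; _/_; _≡ᵇ_; _<ᵇ_; NonZero; s≤s)
open import Data.Nat.DivMod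
  using (_mod_; m≡m%n+[m/n]*n; m%n<n; m<n⇒m%n≡m; [m+n]%n≡m%n; [m+kn]%n≡m%n; %-distribˡ-+; m%n%n≡m%n)
import Data.Nat.Properties as ℕP
open import Data.Nat.Tactic.RingSolver using (solve-∀)
open import Data.Product using (_,_; ∃)
open import Data.Sum using (inj₁; inj₂)
open import Data.Rational as ℚ using (ℚ; 0ℚ; 1ℚ; _+_; _*_; -_)
import Data.Rational.Properties as ℚP
open import Data.Rational.Solver using (module +-*-Solver)
open import Algebra.Properties.Group ℚP.+-0-group using (⁻¹-involutive)
open import Algebra.Bundles using (CommutativeMonoid)
open import Algebra.Properties.CommutativeSemigroup
  (CommutativeMonoid.commutativeSemigroup ℚP.+-0-commutativeMonoid) using (interchange)
open import Relation.Binary.PropositionalEquality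
open ≡-Reasoning
open Equivalence using (to; from)

𝟙 : Bool → ℚ
𝟙 b = if b then 1ℚ else 0ℚ

𝟙-true : ∀ {b} (v : ℚ) → T b → 𝟙 b * v ≡ v
𝟙-true {true} v _ = ℚP.*-identityˡ v

𝟙-false : ∀ {b} (v : ℚ) → ¬ T b → 𝟙 b * v ≡ 0ℚ
𝟙-false {true}  v ¬b = ⊥-elim (¬b _)
𝟙-false {false} v _  = ℚP.*-zeroˡ v

𝟙-∨ : ∀ a b → (T a → T b → ⊥) → 𝟙 (a ∨ b) ≡ 𝟙 a + 𝟙 b
𝟙-∨ true  true  disjoint = ⊥-elim (disjoint _ _)
𝟙-∨ true  false _ = refl
𝟙-∨ false true  _ = refl
𝟙-∨ false false _ = refl

Σᶠ-cong : ∀ m {f g : Fin m → ℚ} → (∀ j → f j ≡ g j) → Σᶠ m f ≡ Σᶠ m g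
Σᶠ-cong zero    f≗g = refl
Σᶠ-cong (suc m) f≗g = cong₂ _+_ (f≗g Fin.zero) (Σᶠ-cong m (λ j → f≗g (Fin.suc j)))

Σᶠ-+ : ∀ m (f g : Fin m → ℚ) → Σᶠ m (λ j → f j + g j) ≡ Σᶠ m f + Σᶠ m g
Σᶠ-+ zero    f g = refl
Σᶠ-+ (suc m) f g = begin
  (f₀ + g₀) + Σᶠ m (λ j → f (Fin.suc j) + g (Fin.suc j))
    ≡⟨ cong ((f₀ + g₀) +_) (Σᶠ-+ m (λ j → f (Fin.suc j)) (λ j → g (Fin.suc j))) ⟩
  (f₀ + g₀) + (Σᶠ m (λ j → f (Fin.suc j)) + Σᶠ m (λ j → g (Fin.suc j)))
    ≡⟨ interchange f₀ g₀ _ _ ⟩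
  Σᶠ (suc m) f + Σᶠ (suc m) g ∎
  where
  f₀ = f Fin.zero
  g₀ = g Fin.zero

Σᶠ-zero : ∀ m (f : Fin m → ℚ) → (∀ j → f j ≡ 0ℚ) → Σᶠ m f ≡ 0ℚ
Σᶠ-zero zero    f f≗0 = refl
Σᶠ-zero (suc m) f f≗0 = cong₂ _+_ (f≗0 Fin.zero) (Σᶠ-zero m (λ j → f (Fin.suc j)) (λ j → f≗0 (Fin.suc j)))

Selects : ∀ {m} → (Fin m → Bool) → Fin m → Set
Selects p t = ∀ j → T (p j) ⇔ j ≡ t

Σᶠ-select : ∀ m (p : Fin m → Bool) (y : Fin m → ℚ) (t : Fin m) →
            Selects p t → Σᶠ m (λ j → 𝟙 (p j) * y j) ≡ y t
Σᶠ-select (suc m) p y Fin.zero sel = begin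
  𝟙 (p Fin.zero) * y Fin.zero + Σᶠ m (λ j → 𝟙 (p (Fin.suc j)) * y (Fin.suc j))
    ≡⟨ cong₂ _+_ (𝟙-true (y Fin.zero) (from (sel Fin.zero) refl))
                 (Σᶠ-zero m _ (λ j → 𝟙-false (y (Fin.suc j)) (λ pj → 0≢1+n (sym (to (sel (Fin.suc j)) pj))))) ⟩
  y Fin.zero + 0ℚ
    ≡⟨ ℚP.+-identityʳ (y Fin.zero) ⟩
  y Fin.zero ∎
Σᶠ-select (suc m) p y (Fin.suc t) sel = begin
  𝟙 (p Fin.zero) * y Fin.zero + Σᶠ m (λ j → 𝟙 (p (Fin.suc j)) * y (Fin.suc j))
    ≡⟨ cong₂ _+_ (𝟙-false (y Fin.zero) (λ p₀ → 0≢1+n (to (sel Fin.zero) p₀)))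
                 (Σᶠ-select m (λ j → p (Fin.suc j)) (λ j → y (Fin.suc j)) t selectsTail) ⟩
  0ℚ + y (Fin.suc t)
    ≡⟨ ℚP.+-identityˡ (y (Fin.suc t)) ⟩
  y (Fin.suc t) ∎
  where
  selectsTail : Selects (λ j → p (Fin.suc j)) t
  selectsTail j = mk⇔ (λ pj → Fin-suc-injective (to (sel (Fin.suc j)) pj))
                      (λ j≡t → from (sel (Fin.suc j)) (cong Fin.suc j≡t))

Disjoint : ∀ {m} → (Fin m → Bool) → (Fin m → Bool) → Set
Disjoint a b = ∀ j → T (a j) → T (b j) → ⊥

Σᶠ-∨ : ∀ m (a b : Fin m → Bool) (y : Fin m → ℚ) → Disjoint a b →
       Σᶠ m (λ j → 𝟙 (a j ∨ b j) * y j) ≡ Σᶠ m (λ j → 𝟙 (a j) * y j) + Σᶠ m (λ j → 𝟙 (b j) * y j)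
Σᶠ-∨ m a b y disjoint = begin
  Σᶠ m (λ j → 𝟙 (a j ∨ b j) * y j)
    ≡⟨ Σᶠ-cong m (λ j → trans (cong (_* y j) (𝟙-∨ (a j) (b j) (disjoint j)))
                              (ℚP.*-distribʳ-+ (y j) (𝟙 (a j)) (𝟙 (b j)))) ⟩
  Σᶠ m (λ j → 𝟙 (a j) * y j + 𝟙 (b j) * y j)
    ≡⟨ Σᶠ-+ m _ _ ⟩
  Σᶠ m (λ j → 𝟙 (a j) * y j) + Σᶠ m (λ j → 𝟙 (b j) * y j) ∎

selects-disjoint : ∀ {m} {a b : Fin m → Bool} {s t} → Selects a s → Selects b t → s ≢ t → Disjoint a b
selects-disjoint sa sb s≢t j aj bj = s≢t (trans (sym (to (sa j) aj)) (to (sb j) bj))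

disjoint-∨ : ∀ {m} {a b c : Fin m → Bool} → Disjoint a b → Disjoint a c → Disjoint a (λ j → b j ∨ c j)
disjoint-∨ {b = b} ab ac j aj bcj with to (T-∨ {b j}) bcj
... | inj₁ bj = ab j aj bj
... | inj₂ cj = ac j aj cj

Periodic : ℕ → (ℕ → ℚ) → Set
Periodic p X = ∀ t → X (p ℕ.+ t) ≡ X t

periodic-multiple : ∀ {p X} → Periodic p X → ∀ q → Periodic (q ℕ.* p) X
periodic-multiple per zero    t = refl
periodic-multiple {p} {X} per (suc q) t = begin
  X ((p ℕ.+ q ℕ.* p) ℕ.+ t) ≡⟨ cong X (ℕP.+-assoc p (q ℕ.* p) t) ⟩
  X (p ℕ.+ (q ℕ.* p ℕ.+ t)) ≡⟨ per (q ℕ.* p ℕ.+ t) ⟩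
  X (q ℕ.* p ℕ.+ t)         ≡⟨ periodic-multiple per q t ⟩
  X t ∎

periodic-remainder : ∀ {p X} q r → Periodic p X → Periodic (q ℕ.* p ℕ.+ r) X → Periodic r X
periodic-remainder {p} {X} q r perₚ per t = begin
  X (r ℕ.+ t)                 ≡⟨ periodic-multiple perₚ q (r ℕ.+ t) ⟨
  X (q ℕ.* p ℕ.+ (r ℕ.+ t))   ≡⟨ cong X (ℕP.+-assoc (q ℕ.* p) r t) ⟨
  X ((q ℕ.* p ℕ.+ r) ℕ.+ t)   ≡⟨ per t ⟩
  X t ∎

periodic-mod : ∀ {m X} .{{_ : NonZero m}} → Periodic m X → ∀ t → X (t % m) ≡ X t
periodic-mod {m} {X} per t = begin
  X (t % m)                     ≡⟨ periodic-multiple per (t / m) (t % m) ⟨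
  X (t / m ℕ.* m ℕ.+ t % m)     ≡⟨ cong X (ℕP.+-comm (t / m ℕ.* m) (t % m)) ⟩
  X (t % m ℕ.+ t / m ℕ.* m)     ≡⟨ cong X (m≡m%n+[m/n]*n t m) ⟨
  X t ∎

open +-*-Solver using (solve; _:+_; _:*_; :-_; _:=_; con)

neg-involutive : ∀ (x : ℚ) → - (- x) ≡ x
neg-involutive = ⁻¹-involutive

_·_ : ℕ → ℚ → ℚ
zero  · u = 0ℚ
suc j · u = u + j · u

·-as-* : ∀ j u → j · u ≡ (j · 1ℚ) * u
·-as-* zero    u = sym (ℚP.*-zeroˡ u)
·-as-* (suc j) u = begin
  u + j · u              ≡⟨ cong (u +_) (·-as-* j u) ⟩
  u + (j · 1ℚ) * u       ≡⟨ solve 2 (λ u c → u :+ c :* u := (con 1ℚ :+ c) :* u) refl u (j · 1ℚ) ⟩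
  (1ℚ + j · 1ℚ) * u ∎

·-nonNegative : ∀ j → 0ℚ ℚ.≤ j · 1ℚ
·-nonNegative zero    = ℚP.≤-refl
·-nonNegative (suc j) = ℚP.+-mono-≤ (ℚP.<⇒≤ (ℚP.positive⁻¹ 1ℚ)) (·-nonNegative j)

*-cancelˡ-zero : ∀ {c u} → c ≢ 0ℚ → c * u ≡ 0ℚ → u ≡ 0ℚ
*-cancelˡ-zero {c} {u} c≢0 cu≡0 = begin
  u                 ≡⟨ ℚP.*-identityˡ u ⟨
  1ℚ * u            ≡⟨ cong (_* u) (ℚP.*-inverseˡ c) ⟨
  (ℚ.1/ c) * c * u  ≡⟨ ℚP.*-assoc (ℚ.1/ c) c u ⟩
  (ℚ.1/ c) * (c * u) ≡⟨ cong ((ℚ.1/ c) *_) cu≡0 ⟩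
  (ℚ.1/ c) * 0ℚ     ≡⟨ ℚP.*-zeroʳ (ℚ.1/ c) ⟩
  0ℚ ∎
  where instance _ = ℚ.≢-nonZero c≢0

+-cancel-to-zero : ∀ x r → x + r ≡ x → r ≡ 0ℚ
+-cancel-to-zero x r x+r≡x = begin
  r                 ≡⟨ solve 2 (λ x r → r := (:- x) :+ (x :+ r)) refl x r ⟩
  - x + (x + r)     ≡⟨ cong (- x +_) x+r≡x ⟩
  - x + x           ≡⟨ ℚP.+-inverseˡ x ⟩
  0ℚ ∎

·-cancel : ∀ j u → suc j · u ≡ 0ℚ → u ≡ 0ℚ
·-cancel j u ju≡0 = *-cancelˡ-zero (λ eq → ℚP.<⇒≢ positive (sym eq)) (trans (sym (·-as-* (suc j) u)) ju≡0)
  where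
  positive : 0ℚ ℚ.< suc j · 1ℚ
  positive = ℚP.+-mono-<-≤ (ℚP.positive⁻¹ 1ℚ) (·-nonNegative j)

-- The kernel equation of Ci_m(1,2) at vertex k+2, read on a sequence X of
-- vertex values: the neighbours of k+2 are k+1, k, k+3 and k+4.
Recurrence : (ℕ → ℚ) → Set
Recurrence X = ∀ k → X (1 ℕ.+ k) + (X k + (X (3 ℕ.+ k) + X (4 ℕ.+ k))) ≡ 0ℚ

recurrence-cong : ∀ {X Z} → (∀ t → X t ≡ Z t) → Recurrence X → Recurrence Z
recurrence-cong {X} {Z} X≗Z rec k = begin
  Z (1 ℕ.+ k) + (Z k + (Z (3 ℕ.+ k) + Z (4 ℕ.+ k)))
    ≡⟨ cong₂ _+_ (sym (X≗Z _)) (cong₂ _+_ (sym (X≗Z _)) (cong₂ _+_ (sym (X≗Z _)) (sym (X≗Z _)))) ⟩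
  X (1 ℕ.+ k) + (X k + (X (3 ℕ.+ k) + X (4 ℕ.+ k)))
    ≡⟨ rec k ⟩
  0ℚ ∎

alternating : ℕ → ℚ
alternating zero    = 1ℚ
alternating (suc k) = - alternating k

alternating-nonzero : ∀ k → alternating k ≢ 0ℚ
alternating-nonzero zero    ()
alternating-nonzero (suc k) eq = alternating-nonzero k (ℚP.neg-injective eq)

alternating-periodic : Periodic 2 alternating
alternating-periodic t = neg-involutive (alternating t)

alternating-recurrence : Recurrence alternating
alternating-recurrence k =
  solve 1 (λ a → (:- a) :+ (a :+ ((:- (:- (:- a))) :+ (:- (:- (:- (:- a)))))) := con 0ℚ) refl (alternating k)

hexagonal : ℕ → ℚ
hexagonal 0 = 1ℚ
hexagonal 1 = 1ℚ
hexagonal 2 = 0ℚ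
hexagonal 3 = - 1ℚ
hexagonal 4 = - 1ℚ
hexagonal 5 = 0ℚ
hexagonal (suc (suc (suc (suc (suc (suc k)))))) = hexagonal k

hexagonal-periodic : Periodic 6 hexagonal
hexagonal-periodic t = refl

hexagonal-recurrence : Recurrence hexagonal
hexagonal-recurrence 0 = refl
hexagonal-recurrence 1 = refl
hexagonal-recurrence 2 = refl
hexagonal-recurrence 3 = refl
hexagonal-recurrence 4 = refl
hexagonal-recurrence 5 = refl
hexagonal-recurrence (suc (suc (suc (suc (suc (suc k)))))) = hexagonal-recurrence k

pairSum : (ℕ → ℚ) → ℕ → ℚ
pairSum X k = X k + X (1 ℕ.+ k)

pairSum-antiperiodic : ∀ {X} → Recurrence X → ∀ k → pairSum X (3 ℕ.+ k) ≡ - pairSum X k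
pairSum-antiperiodic {X} rec k = begin
  c + d                                ≡⟨ solve 4 (λ a b c d → c :+ d := (:- (b :+ a)) :+ (a :+ (b :+ (c :+ d)))) refl a b c d ⟩
  - (b + a) + (a + (b + (c + d)))      ≡⟨ cong (- (b + a) +_) (rec k) ⟩
  - (b + a) + 0ℚ                       ≡⟨ ℚP.+-identityʳ (- (b + a)) ⟩
  - pairSum X k ∎
  where
  a = X (1 ℕ.+ k)
  b = X k
  c = X (3 ℕ.+ k)
  d = X (4 ℕ.+ k)

pairSum-periodic6 : ∀ {X} → Recurrence X → Periodic 6 (pairSum X)
pairSum-periodic6 {X} rec t = begin
  pairSum X (3 ℕ.+ (3 ℕ.+ t))   ≡⟨ pairSum-antiperiodic {X} rec (3 ℕ.+ t) ⟩
  - pairSum X (3 ℕ.+ t)         ≡⟨ cong -_ (pairSum-antiperiodic {X} rec t) ⟩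
  - (- pairSum X t)             ≡⟨ neg-involutive (pairSum X t) ⟩
  pairSum X t ∎

pairSum-periodic : ∀ {p X} → Periodic p X → Periodic p (pairSum X)
pairSum-periodic {p} {X} per t =
  cong₂ _+_ (per t) (trans (cong X (sym (ℕP.+-suc p t))) (per (1 ℕ.+ t)))

Alternates : (ℕ → ℚ) → Set
Alternates X = ∀ k → pairSum X (1 ℕ.+ k) ≡ - pairSum X k

-- Periods 6 and 2n combine to the period 2 (n mod 3); when 3 ∤ n this
-- is 2 or 4, and either way the pair sums alternate in sign.
pairSum-alternates : ∀ {X} n → ¬ 3 ∣ n → Recurrence X → Periodic (2 ℕ.* n) X → Alternates X
pairSum-alternates {X} n 3∤n rec per =
  alternates (n % 3) refl (periodic-remainder (n / 3) (2 ℕ.* (n % 3)) (pairSum-periodic6 {X} rec) per′)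
  where
  S = pairSum X
  2n≡6q+2r : 2 ℕ.* n ≡ n / 3 ℕ.* 6 ℕ.+ 2 ℕ.* (n % 3)
  2n≡6q+2r = trans (cong (2 ℕ.*_) (m≡m%n+[m/n]*n n 3)) (arith (n % 3) (n / 3))
    where
    arith : ∀ r q → 2 ℕ.* (r ℕ.+ q ℕ.* 3) ≡ q ℕ.* 6 ℕ.+ 2 ℕ.* r
    arith = solve-∀
  per′ : Periodic (n / 3 ℕ.* 6 ℕ.+ 2 ℕ.* (n % 3)) S
  per′ = subst (λ p → Periodic p S) 2n≡6q+2r (pairSum-periodic per)
  alternates : ∀ r → n % 3 ≡ r → Periodic (2 ℕ.* r) S → Alternates X
  alternates 0 r≡0 _ k = ⊥-elim (3∤n (m%n≡0⇒n∣m n 3 r≡0))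
  alternates 1 _ per₂ k = trans (sym (per₂ (1 ℕ.+ k))) (pairSum-antiperiodic {X} rec k)
  alternates 2 _ per₄ k = begin
    S (1 ℕ.+ k)            ≡⟨ neg-involutive (S (1 ℕ.+ k)) ⟨
    - (- S (1 ℕ.+ k))      ≡⟨ cong -_ (pairSum-antiperiodic {X} rec (1 ℕ.+ k)) ⟨
    - S (4 ℕ.+ k)          ≡⟨ cong -_ (per₄ k) ⟩
    - S k ∎
  alternates (suc (suc (suc r))) r≡3+r _ k =
    ⊥-elim (ℕP.<⇒≱ (m%n<n n 3) (subst (3 ℕ.≤_) (sym r≡3+r) (ℕP.m≤m+n 3 r)))

alternates-even : ∀ {X} → Alternates X → ∀ j → pairSum X (j ℕ.* 2) ≡ pairSum X 0
alternates-even         alt zero    = refl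
alternates-even {X} alt (suc j) = begin
  S (2 ℕ.+ j ℕ.* 2)       ≡⟨ alt (1 ℕ.+ j ℕ.* 2) ⟩
  - S (1 ℕ.+ j ℕ.* 2)     ≡⟨ cong -_ (alt (j ℕ.* 2)) ⟩
  - (- S (j ℕ.* 2))       ≡⟨ neg-involutive (S (j ℕ.* 2)) ⟩
  S (j ℕ.* 2)             ≡⟨ alternates-even {X} alt j ⟩
  S 0 ∎
  where S = pairSum X

-- With alternating pair sums, X (k+2) = X k - 2 S k, and S k = S 0 for even k;
-- so each double step from an even index lowers X by 2 S 0.
alternates-descent : ∀ {X} → Alternates X → ∀ j → X (j ℕ.* 2) + j · (pairSum X 0 + pairSum X 0) ≡ X 0
alternates-descent {X} alt zero    = ℚP.+-identityʳ (X 0)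
alternates-descent {X} alt (suc j) = begin
  X (2 ℕ.+ 2j) + (u + j · u)                  ≡⟨ ℚP.+-assoc (X (2 ℕ.+ 2j)) u (j · u) ⟨
  X (2 ℕ.+ 2j) + u + j · u                    ≡⟨ cong (λ s → X (2 ℕ.+ 2j) + (s + s) + j · u) (alternates-even {X} alt j) ⟨
  X (2 ℕ.+ 2j) + (S 2j + S 2j) + j · u        ≡⟨ cong (_+ j · u) (double-step 2j) ⟩
  X 2j + j · u                                ≡⟨ alternates-descent {X} alt j ⟩
  X 0 ∎
  where
  S = pairSum X
  u = S 0 + S 0
  2j = j ℕ.* 2
  double-step : ∀ k → X (2 ℕ.+ k) + (S k + S k) ≡ X k
  double-step k = begin
    c + ((a + b) + (a + b))     ≡⟨ solve 3 (λ a b c → c :+ ((a :+ b) :+ (a :+ b)) := a :+ ((b :+ c) :+ (a :+ b))) refl a b c ⟩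
    a + (S (1 ℕ.+ k) + S k)     ≡⟨ cong (λ s → a + (s + S k)) (alt k) ⟩
    a + (- S k + S k)           ≡⟨ cong (a +_) (ℚP.+-inverseˡ (S k)) ⟩
    a + 0ℚ                      ≡⟨ ℚP.+-identityʳ a ⟩
    a ∎
    where
    a = X k
    b = X (1 ℕ.+ k)
    c = X (2 ℕ.+ k)

-- Going once around a cycle of length 2(1+w) lowers X by (1+w) · 2 S 0;
-- periodicity makes this zero, hence S 0 = 0.
pairSum-vanishes : ∀ {X} w → Periodic (2 ℕ.* suc w) X → Alternates X → pairSum X 0 ≡ 0ℚ
pairSum-vanishes {X} w per alt = ·-cancel 1 (S 0) (begin
  S 0 + (S 0 + 0ℚ)        ≡⟨ cong (S 0 +_) (ℚP.+-identityʳ (S 0)) ⟩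
  u                       ≡⟨ ·-cancel w u (+-cancel-to-zero (X 0) (suc w · u) around) ⟩
  0ℚ ∎)
  where
  S = pairSum X
  u = S 0 + S 0
  around : X 0 + suc w · u ≡ X 0
  around = begin
    X 0 + suc w · u                      ≡⟨ cong (_+ suc w · u) (per 0) ⟨
    X (2 ℕ.* suc w ℕ.+ 0) + suc w · u    ≡⟨ cong (λ i → X i + suc w · u) (trans (ℕP.+-identityʳ _) (ℕP.*-comm 2 (suc w))) ⟩
    X (suc w ℕ.* 2) + suc w · u          ≡⟨ alternates-descent {X} alt (suc w) ⟩
    X 0 ∎

pairSum-zero⇒alternating : ∀ {X} → (∀ k → pairSum X k ≡ 0ℚ) → ∀ k → X k ≡ alternating k * X 0
pairSum-zero⇒alternating {X} S≡0 zero    = sym (ℚP.*-identityˡ (X 0))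
pairSum-zero⇒alternating {X} S≡0 (suc k) = begin
  X (suc k)                       ≡⟨ solve 2 (λ a b → b := (:- a) :+ (a :+ b)) refl (X k) (X (suc k)) ⟩
  - X k + pairSum X k             ≡⟨ cong (- X k +_) (S≡0 k) ⟩
  - X k + 0ℚ                      ≡⟨ ℚP.+-identityʳ (- X k) ⟩
  - X k                           ≡⟨ cong -_ (pairSum-zero⇒alternating {X} S≡0 k) ⟩
  - (alternating k * X 0)         ≡⟨ ℚP.neg-distribˡ-* (alternating k) (X 0) ⟩
  alternating (suc k) * X 0 ∎

alternating-solution : ∀ {X} n → ¬ 3 ∣ n → Recurrence X → Periodic (2 ℕ.* n) X →
                       ∀ k → X k ≡ alternating k * X 0
alternating-solution zero    3∤0 rec per = ⊥-elim (3∤0 (divides 0 refl))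
alternating-solution {X} (suc w) 3∤n rec per = pairSum-zero⇒alternating {X} S≡0
  where
  alt : Alternates X
  alt = pairSum-alternates (suc w) 3∤n rec per
  S≡0 : ∀ k → pairSum X k ≡ 0ℚ
  S≡0 zero    = pairSum-vanishes w per alt
  S≡0 (suc k) = trans (alt k) (cong -_ (S≡0 k))

nut-criterion : ∀ {K} (G : Graph (suc K)) x → InKernel G x → (∀ i → x i ≢ 0ℚ) →
                (∀ y → InKernel G y → ∃ λ c → ∀ i → y i ≡ c * x i) → NutGraph G
nut-criterion G x ker nowhere-zero spans =
  ((x , ker , nonzero) , λ v → x , ker , nowhere-zero v) , (x , ker , nonzero , spans)
  where
  nonzero : NonZeroVec x
  nonzero = Fin.zero , nowhere-zero Fin.zero

independent⇒¬nullityOne : ∀ {m} (G : Graph m) (u v : Fin m → ℚ) i j →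
                          InKernel G u → InKernel G v →
                          u i ≡ 0ℚ → u j ≢ 0ℚ → v i ≢ 0ℚ → ¬ NullityOne G
independent⇒¬nullityOne G u v i j keru kerv ui≡0 uj≢0 vi≢0 (x , _ , _ , spans)
  with spans u keru | spans v kerv
... | c , u≡cx | d , v≡dx = uj≢0 (begin
  u j          ≡⟨ u≡cx j ⟩
  c * x j      ≡⟨ cong (_* x j) c≡0 ⟩
  0ℚ * x j     ≡⟨ ℚP.*-zeroˡ (x j) ⟩
  0ℚ ∎)
  where
  c≡0 : c ≡ 0ℚ
  c≡0 = *-cancelˡ-zero vi≢0 (begin
    v i * c          ≡⟨ cong (_* c) (v≡dx i) ⟩
    d * x i * c      ≡⟨ solve 3 (λ d x c → d :* x :* c := d :* (c :* x)) refl d (x i) c ⟩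
    d * (c * x i)    ≡⟨ cong (d *_) (sym (u≡cx i)) ⟩
    d * u i          ≡⟨ cong (d *_) ui≡0 ⟩
    d * 0ℚ           ≡⟨ ℚP.*-zeroʳ d ⟩
    0ℚ ∎)

-- The circulant graph Ci_m(1,2) on ℤ_m, m = 1 + K (for m = 2n it is the
-- antiprism A_n), and the translation between its kernel and the recurrence.
module Circulant (K : ℕ) where

  m : ℕ
  m = suc K

  ⟦_⟧ : ℕ → Fin m
  ⟦ t ⟧ = t mod m

  toℕ-⟦⟧ : ∀ t → toℕ ⟦ t ⟧ ≡ t % m
  toℕ-⟦⟧ t = toℕ-fromℕ< (m%n<n t m)

  ⟦⟧-cong : ∀ a b → a % m ≡ b % m → ⟦ a ⟧ ≡ ⟦ b ⟧
  ⟦⟧-cong a b eq = fromℕ<-cong (a % m) (b % m) eq (m%n<n a m) (m%n<n b m)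

  ⟦⟧-injective : ∀ a b → ⟦ a ⟧ ≡ ⟦ b ⟧ → a % m ≡ b % m
  ⟦⟧-injective a b eq = trans (sym (toℕ-⟦⟧ a)) (trans (cong toℕ eq) (toℕ-⟦⟧ b))

  ⟦toℕ⟧ : ∀ j → ⟦ toℕ j ⟧ ≡ j
  ⟦toℕ⟧ j = toℕ-injective (trans (toℕ-⟦⟧ (toℕ j)) (m<n⇒m%n≡m (toℕ<n j)))

  ⟦m+⟧ : ∀ t → ⟦ m ℕ.+ t ⟧ ≡ ⟦ t ⟧
  ⟦m+⟧ t = ⟦⟧-cong (m ℕ.+ t) t (trans (cong (_% m) (ℕP.+-comm m t)) ([m+n]%n≡m%n t m))

  ⟦⟧-+ : ∀ t d → ⟦ toℕ ⟦ t ⟧ ℕ.+ d ⟧ ≡ ⟦ d ℕ.+ t ⟧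
  ⟦⟧-+ t d = ⟦⟧-cong (toℕ ⟦ t ⟧ ℕ.+ d) (d ℕ.+ t) (begin
    (toℕ ⟦ t ⟧ ℕ.+ d) % m           ≡⟨ %-distribˡ-+ (toℕ ⟦ t ⟧) d m ⟩
    (toℕ ⟦ t ⟧ % m ℕ.+ d % m) % m   ≡⟨ cong (λ r → (r % m ℕ.+ d % m) % m) (toℕ-⟦⟧ t) ⟩
    (t % m % m ℕ.+ d % m) % m       ≡⟨ cong (λ r → (r ℕ.+ d % m) % m) (m%n%n≡m%n t m) ⟩
    (t % m ℕ.+ d % m) % m           ≡⟨ %-distribˡ-+ t d m ⟨
    (t ℕ.+ d) % m                   ≡⟨ cong (_% m) (ℕP.+-comm t d) ⟩
    (d ℕ.+ t) % m ∎)

  ⟦⟧-+-cancel : ∀ d {a b} → ⟦ d ℕ.+ a ⟧ ≡ ⟦ d ℕ.+ b ⟧ → ⟦ a ⟧ ≡ ⟦ b ⟧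
  ⟦⟧-+-cancel d {a} {b} eq = ⟦⟧-cong a b (begin
    a % m                           ≡⟨ [m+kn]%n≡m%n a d m ⟨
    (a ℕ.+ d ℕ.* m) % m             ≡⟨ cong (_% m) (shift a) ⟩
    ((d ℕ.+ a) ℕ.+ d ℕ.* K) % m     ≡⟨ %-distribˡ-+ (d ℕ.+ a) (d ℕ.* K) m ⟩
    ((d ℕ.+ a) % m ℕ.+ d ℕ.* K % m) % m
                                    ≡⟨ cong (λ r → (r ℕ.+ d ℕ.* K % m) % m) (⟦⟧-injective (d ℕ.+ a) (d ℕ.+ b) eq) ⟩
    ((d ℕ.+ b) % m ℕ.+ d ℕ.* K % m) % m
                                    ≡⟨ %-distribˡ-+ (d ℕ.+ b) (d ℕ.* K) m ⟨
    ((d ℕ.+ b) ℕ.+ d ℕ.* K) % m     ≡⟨ cong (_% m) (shift b) ⟨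
    (b ℕ.+ d ℕ.* m) % m             ≡⟨ [m+kn]%n≡m%n b d m ⟩
    b % m ∎)
    where
    -- adding the multiple d·m of m leaves the residue unchanged, and
    -- x + d·m = (d + x) + d·K turns this into cancellation of d
    shift : ∀ x → x ℕ.+ d ℕ.* m ≡ (d ℕ.+ x) ℕ.+ d ℕ.* K
    shift x = identity x d K
      where
      identity : ∀ x d K → x ℕ.+ d ℕ.* suc K ≡ (d ℕ.+ x) ℕ.+ d ℕ.* K
      identity = solve-∀

  ⟦⟧-distinct : ∀ k {c c'} → c < c' → c' < m → ⟦ c ℕ.+ k ⟧ ≢ ⟦ c' ℕ.+ k ⟧
  ⟦⟧-distinct k {c} {c'} c<c' c'<m eq = ℕP.<⇒≢ c<c' (begin
    c          ≡⟨ m<n⇒m%n≡m (ℕP.<-trans c<c' c'<m) ⟨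
    c % m      ≡⟨ ⟦⟧-injective c c' (⟦⟧-+-cancel k (subst₂ (λ r s → ⟦ r ⟧ ≡ ⟦ s ⟧) (ℕP.+-comm c k) (ℕP.+-comm c' k) eq)) ⟩
    c' % m     ≡⟨ m<n⇒m%n≡m c'<m ⟩
    c' ∎)

  step : ℕ → Fin m → Fin m → Bool
  step d a b = ((toℕ b ℕ.+ d) % m) ≡ᵇ toℕ a

  Ci : Graph m
  Ci i j = step 1 i j ∨ step 2 i j ∨ step 1 j i ∨ step 2 j i

  step-spec : ∀ d a b → T (step d a b) ⇔ ⟦ toℕ b ℕ.+ d ⟧ ≡ a
  step-spec d a b = mk⇔
    (λ s → toℕ-injective (trans (toℕ-⟦⟧ (toℕ b ℕ.+ d)) (ℕP.≡ᵇ⇒≡ _ _ s)))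
    (λ e → ℕP.≡⇒≡ᵇ _ _ (trans (sym (toℕ-⟦⟧ (toℕ b ℕ.+ d))) (cong toℕ e)))

  selects-below : ∀ d t → Selects (step d ⟦ d ℕ.+ t ⟧) ⟦ t ⟧
  selects-below d t j = mk⇔
    (λ s → begin
      j                 ≡⟨ ⟦toℕ⟧ j ⟨
      ⟦ toℕ j ⟧         ≡⟨ ⟦⟧-+-cancel d (trans (cong ⟦_⟧ (ℕP.+-comm d (toℕ j))) (to (step-spec d ⟦ d ℕ.+ t ⟧ j) s)) ⟩
      ⟦ t ⟧ ∎)
    (λ { refl → from (step-spec d ⟦ d ℕ.+ t ⟧ ⟦ t ⟧) (⟦⟧-+ t d) })

  selects-above : ∀ d t → Selects (λ j → step d j ⟦ t ⟧) ⟦ d ℕ.+ t ⟧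
  selects-above d t j = mk⇔
    (λ s → trans (sym (to (step-spec d j ⟦ t ⟧) s)) (⟦⟧-+ t d))
    (λ { refl → from (step-spec d ⟦ d ℕ.+ t ⟧ ⟦ t ⟧) (⟦⟧-+ t d) })

  extend : (Fin m → ℚ) → ℕ → ℚ
  extend y t = y ⟦ t ⟧

  extend-periodic : ∀ y → Periodic m (extend y)
  extend-periodic y t = cong y (⟦m+⟧ t)

  extend-toℕ : ∀ y j → extend y (toℕ j) ≡ y j
  extend-toℕ y j = cong y (⟦toℕ⟧ j)

  -- Row k+2 of A(Ci_m(1,2)) applied to y: the four neighbours k+1, k, k+3, k+4
  -- are distinct once m > 4, so each contributes its entry exactly once.
  neighbour-sum : 4 < m → ∀ y k →
                  Σᶠ m (λ j → 𝟙 (Ci ⟦ 2 ℕ.+ k ⟧ j) * y j)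
                    ≡ extend y (1 ℕ.+ k) + (extend y k + (extend y (3 ℕ.+ k) + extend y (4 ℕ.+ k)))
  neighbour-sum 4<m y k = begin
    Σ (λ j → a j ∨ b j ∨ c j ∨ d j)
      ≡⟨ Σᶠ-∨ m a _ y (disjoint-∨ a#b (disjoint-∨ a#c a#d)) ⟩
    Σ a + Σ (λ j → b j ∨ c j ∨ d j)
      ≡⟨ cong (Σ a +_) (Σᶠ-∨ m b _ y (disjoint-∨ b#c b#d)) ⟩
    Σ a + (Σ b + Σ (λ j → c j ∨ d j))
      ≡⟨ cong (λ s → Σ a + (Σ b + s)) (Σᶠ-∨ m c d y c#d) ⟩
    Σ a + (Σ b + (Σ c + Σ d))
      ≡⟨ cong₂ _+_ (Σᶠ-select m a y _ sa)
           (cong₂ _+_ (Σᶠ-select m b y _ sb) (cong₂ _+_ (Σᶠ-select m c y _ sc) (Σᶠ-select m d y _ sd))) ⟩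
    extend y (1 ℕ.+ k) + (extend y k + (extend y (3 ℕ.+ k) + extend y (4 ℕ.+ k))) ∎
    where
    i = ⟦ 2 ℕ.+ k ⟧
    Σ : (Fin m → Bool) → ℚ
    Σ p = Σᶠ m (λ j → 𝟙 (p j) * y j)
    a b c d : Fin m → Bool
    a j = step 1 i j
    b j = step 2 i j
    c j = step 1 j i
    d j = step 2 j i
    sa = selects-below 1 (1 ℕ.+ k)
    sb = selects-below 2 k
    sc = selects-above 1 (2 ℕ.+ k)
    sd = selects-above 2 (2 ℕ.+ k)
    apart : ∀ r s → {T (r <ᵇ s)} → {T (s <ᵇ 5)} → ⟦ r ℕ.+ k ⟧ ≢ ⟦ s ℕ.+ k ⟧
    apart r s {r<s} {s<5} = ⟦⟧-distinct k (ℕP.<ᵇ⇒< r s r<s) (ℕP.≤-trans (ℕP.<ᵇ⇒< s 5 s<5) 4<m)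
    a#b = selects-disjoint sa sb (≢-sym (apart 0 1))
    a#c = selects-disjoint sa sc (apart 1 3)
    a#d = selects-disjoint sa sd (apart 1 4)
    b#c = selects-disjoint sb sc (apart 0 3)
    b#d = selects-disjoint sb sd (apart 0 4)
    c#d = selects-disjoint sc sd (apart 3 4)

  vertex-shift : 2 ℕ.≤ m → ∀ i → ⟦ 2 ℕ.+ (m ℕ.∸ 2 ℕ.+ toℕ i) ⟧ ≡ i
  vertex-shift 2≤m i = begin
    ⟦ 2 ℕ.+ (m ℕ.∸ 2 ℕ.+ toℕ i) ⟧   ≡⟨ cong ⟦_⟧ (ℕP.+-assoc 2 (m ℕ.∸ 2) (toℕ i)) ⟨
    ⟦ 2 ℕ.+ (m ℕ.∸ 2) ℕ.+ toℕ i ⟧   ≡⟨ cong (λ r → ⟦ r ℕ.+ toℕ i ⟧) (ℕP.m+[n∸m]≡n 2≤m) ⟩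
    ⟦ m ℕ.+ toℕ i ⟧                 ≡⟨ ⟦m+⟧ (toℕ i) ⟩
    ⟦ toℕ i ⟧                       ≡⟨ ⟦toℕ⟧ i ⟩
    i ∎

  kernel⇒recurrence : 4 < m → ∀ y → InKernel Ci y → Recurrence (extend y)
  kernel⇒recurrence 4<m y ker k = trans (sym (neighbour-sum 4<m y k)) (ker ⟦ 2 ℕ.+ k ⟧)

  recurrence⇒kernel : 4 < m → ∀ X → Periodic m X → Recurrence X → InKernel Ci (λ j → X (toℕ j))
  recurrence⇒kernel 4<m X per rec i =
    subst (λ v → Σᶠ m (λ j → 𝟙 (Ci v j) * x j) ≡ 0ℚ) (vertex-shift 2≤m i)
          (trans (neighbour-sum 4<m x k) (recurrence-cong extend-x rec k))
    where
    x : Fin m → ℚ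
    x j = X (toℕ j)
    k = m ℕ.∸ 2 ℕ.+ toℕ i
    2≤m : 2 ℕ.≤ m
    2≤m = ℕP.≤-trans (ℕP.m≤m+n 2 2) (ℕP.<⇒≤ 4<m)
    extend-x : ∀ t → X t ≡ extend x t
    extend-x t = sym (trans (cong X (toℕ-⟦⟧ t)) (periodic-mod per t))

  periodic-kernel : 4 < m → ∀ {X} p q → m ≡ q ℕ.* p → Periodic p X → Recurrence X →
                    InKernel Ci (λ j → X (toℕ j))
  periodic-kernel 4<m {X} p q m≡qp per rec =
    recurrence⇒kernel 4<m X (subst (λ r → Periodic r X) (sym m≡qp) (periodic-multiple per q)) rec

  alternating-kernel : 4 < m → ∀ n → m ≡ 2 ℕ.* n → InKernel Ci (λ j → alternating (toℕ j))
  alternating-kernel 4<m n m≡2n =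
    periodic-kernel 4<m 2 n (trans m≡2n (ℕP.*-comm 2 n)) alternating-periodic alternating-recurrence

  nut-if-3∤n : 4 < m → ∀ n → m ≡ 2 ℕ.* n → ¬ 3 ∣ n → NutGraph Ci
  nut-if-3∤n 4<m n m≡2n 3∤n =
    nut-criterion Ci _ (alternating-kernel 4<m n m≡2n) (λ i → alternating-nonzero (toℕ i)) spans
    where
    spans : ∀ y → InKernel Ci y → ∃ λ c → ∀ i → y i ≡ c * alternating (toℕ i)
    spans y ker = extend y 0 , λ i → begin
      y i                               ≡⟨ extend-toℕ y i ⟨
      extend y (toℕ i)                  ≡⟨ alternating-solution n 3∤n (kernel⇒recurrence 4<m y ker) per (toℕ i) ⟩
      alternating (toℕ i) * extend y 0  ≡⟨ ℚP.*-comm (alternating (toℕ i)) (extend y 0) ⟩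
      extend y 0 * alternating (toℕ i) ∎
      where
      per : Periodic (2 ℕ.* n) (extend y)
      per = subst (λ p → Periodic p (extend y)) m≡2n (extend-periodic y)

  -- If 3 ∣ n, the hexagonal vector vanishes at vertex 2 where the alternating one
  -- does not, so the two are independent kernel vectors.
  ¬nullityOne-if-3∣n : 4 < m → ∀ n → m ≡ 2 ℕ.* n → 3 ∣ n → ¬ NullityOne Ci
  ¬nullityOne-if-3∣n 4<m n m≡2n (divides q n≡3q) =
    independent⇒¬nullityOne Ci (λ j → hexagonal (toℕ j)) (λ j → alternating (toℕ j)) ⟦ 2 ⟧ Fin.zero
      (periodic-kernel 4<m 6 q m≡6q hexagonal-periodic hexagonal-recurrence) (alternating-kernel 4<m n m≡2n)
      (cong hexagonal toℕ-⟦2⟧) ℚP.1≢0 (alternating-nonzero (toℕ ⟦ 2 ⟧))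
    where
    toℕ-⟦2⟧ : toℕ ⟦ 2 ⟧ ≡ 2
    toℕ-⟦2⟧ = trans (toℕ-⟦⟧ 2) (m<n⇒m%n≡m (ℕP.<-trans (ℕP.m≤m+n 3 1) 4<m))
    m≡6q : m ≡ q ℕ.* 6
    m≡6q = trans m≡2n (trans (cong (2 ℕ.*_) n≡3q) (identity q))
      where
      identity : ∀ q → 2 ℕ.* (q ℕ.* 3) ≡ q ℕ.* 6
      identity = solve-∀

proposition4 : (n : ℕ) → 3 ≤ n → NutGraph (antiprism n) ⇔ (¬ (3 ∣ n))
proposition4 (suc zero)       (s≤s ())
proposition4 (suc (suc zero)) (s≤s (s≤s ()))
proposition4 n@(suc (suc (suc _))) 3≤n =
  mk⇔ (λ (_ , nullityOne) 3∣n → ¬nullityOne-if-3∣n 4<m n refl 3∣n nullityOne)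
      (nut-if-3∤n 4<m n refl)
  where
  -- For n ≥ 3 the antiprism A_n is, by definition, Ci_m(1,2) with m = 2n ≥ 6.
  open Circulant (ℕ.pred (2 ℕ.* n))
  4<m : 4 < m
  4<m = ℕP.≤-trans (ℕP.n≤1+n 5) (ℕP.*-monoʳ-≤ 2 3≤n)
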